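{- Let $\Gamma$ be a transitive digraph on $n$ vertices with vertex set $V$ and edge set $E$. If $w(\Gamma) > (3/4)n^2$, then there exists a transitive digraph $\Gamma'$ on $n$ vertices such that $w(\Gamma) = w(\Gamma')$ and $\Gamma'$ has at least one mother vertex.
   Context: Digraphs are finite directed graphs without loops; an edge is an ordered pair $(\alpha,\beta)$ of distinct vertices. A digraph is transitive if whenever $(\alpha,\beta)$ and $(\beta,\gamma)$ are edges with $\alpha\neq\gamma$, then $(\alpha,\gamma)$ is an edge. A reachable pair of a digraph $\Gamma$ is an ordered pair $(\alpha,\beta)$ of (not necessarily distinct) vertices such that there is a directed path (possibly of length $0$) from $\alpha$ to $\beta$. The weight $w(\Gamma)$ is the number of reachable pairs of $\Gamma$; for a transitive digraph on $n$ vertices this equals $n$ plus the number of edges. In a transitive digraph, a mother vertex is a vertex $\alpha$ such that $(\alpha,\beta)$ is an edge for every vertex $\beta\neq\alpha$. -}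

module Defs where

open import Data.Nat using (ℕ; _+_)
open import Data.Bool using (Bool; true; false)
open import Data.Fin using (Fin)
open import Data.List using (List; map)
open import Data.Nat.ListAction using (sum)
open import Data.List using (allFin)
open import Data.Product using (_×_)
open import Relation.Binary.PropositionalEquality using (_≡_; _≢_)

record Digraph (n : ℕ) : Set where
  field
    edge  : Fin n → Fin n → Bool
    loopless : ∀ (a : Fin n) → edge a a ≡ false

open Digraph public

Edge : ∀ {n} → Digraph n → Fin n → Fin n → Set
Edge Γ a b = edge Γ a b ≡ true

IsTransitive : ∀ {n} → Digraph n → Set
IsTransitive {n} Γ =
  ∀ (a b c : Fin n) → Edge Γ a b → Edge Γ b c → a ≢ c → Edge Γ a c

boolToℕ : Bool → ℕ
boolToℕ true = 1
boolToℕ false = 0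

numEdges : ∀ {n} → Digraph n → ℕ
numEdges {n} Γ = sum (map (λ a → sum (map (λ b → boolToℕ (edge Γ a b)) (allFin n))) (allFin n))

-- weight of a transitive digraph: n + number of edges (= number of reachable pairs)
weight : ∀ {n} → Digraph n → ℕ
weight {n} Γ = n + numEdges Γ

IsMother : ∀ {n} → Digraph n → Fin n → Set
IsMother {n} Γ a = ∀ (b : Fin n) → a ≢ b → Edge Γ a b

{-# OPTIONS --safe #-}
module Submission where

-- Summing the out-reach and the in-reach of all vertices counts every reachable pair twice, so
-- w(Γ) > n²/2 already gives a vertex v with outReach v + inReach v = n + s, s ≥ 1. By
-- inclusion–exclusion the strong component of v has at least s vertices; take a set S of exactly
-- s of them. Raising S (every vertex of S becomes a mother, no edge enters S from outside, all
-- other edges stay) keeps Γ transitive, and since every vertex of S has the row and the column of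
-- v, the weight changes by s·(n + s) − s·(outReach v + inReach v) = 0.

open import Defs
open import Data.Bool using (Bool; true; false; not; _∧_; if_then_else_)
open import Data.Bool.Properties using (T-≡; ∨-inverseʳ; ∨-identityʳ)
open import Data.Fin using (Fin; zero; suc; _≟_)
open import Data.List using (allFin; tabulate)
import Data.List as List
open import Data.List.Properties using (map-tabulate)
open import Data.Nat using (ℕ; zero; suc; _+_; _*_; _∸_; _≤_; _<_; z≤n; s≤s)
import Data.Nat.ListAction as Listℕ
open import Data.Nat.Properties
  using ( +-*-semiring; +-assoc; +-comm; +-identityʳ; *-distribˡ-+; +-cancelʳ-≡; _<?_; ≤-refl; ≤-pred
        ; <⇒≤; ≮⇒≥; <-≤-trans; +-mono-≤; +-monoˡ-≤; +-cancelˡ-<; *-monoˡ-≤; *-cancelˡ-<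
        ; ∸-monoˡ-≤; m+n∸m≡n; m+[n∸m]≡n; m<n⇒0<n∸m; module ≤-Reasoning)
open import Algebra.Properties.Semiring.Sum +-*-semiring
  using ( sum; sum-syntax; sum-cong-≗; sum-replicate-zero; ∑-distrib-+; ∑-comm
        ; *-distribˡ-sum; *-distribʳ-sum)
open import Data.Nat.Tactic.RingSolver using (solve-∀)
open import Data.Product using (Σ; ∃; ∃-syntax; _×_; _,_; proj₁; proj₂)
open import Data.Sum using (_⊎_; inj₁; inj₂)
open import Function using (id; _∘_)
open import Function.Bundles using (mk⇔)
open import Relation.Binary.PropositionalEquality
  using (_≡_; refl; sym; trans; cong; cong₂; subst; module ≡-Reasoning)
open import Relation.Nullary using (Dec; does; yes; no; T?; _⊎-dec_; _×-dec_; contradiction)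
import Relation.Nullary.Decidable as Dec
open import Relation.Nullary.Decidable using (dec-true; dec-false; does-⇔)

3*x<4*y⇒x<y+y : ∀ x y → 3 * x < 4 * y → x < y + y
3*x<4*y⇒x<y+y x y 3x<4y = *-cancelˡ-< 2 x (y + y) (begin-strict
  2 * x       ≤⟨ *-monoˡ-≤ x {2} {3} (s≤s (s≤s z≤n)) ⟩
  3 * x       <⟨ 3x<4y ⟩
  4 * y       ≡⟨ 4*y≡2*[y+y] y ⟩
  2 * (y + y) ∎)
  where
  open ≤-Reasoning
  4*y≡2*[y+y] : ∀ y → 4 * y ≡ 2 * (y + y)
  4*y≡2*[y+y] = solve-∀

sum-tabulate : ∀ {n} (f : Fin n → ℕ) → Listℕ.sum (tabulate f) ≡ sum f
sum-tabulate {zero}  f = refl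
sum-tabulate {suc n} f = cong (f zero +_) (sum-tabulate (f ∘ suc))

sum-map-allFin : ∀ {n} (f : Fin n → ℕ) → Listℕ.sum (List.map f (allFin n)) ≡ sum f
sum-map-allFin f = trans (cong Listℕ.sum (map-tabulate id f)) (sum-tabulate f)

∑-1 : ∀ n → ∑[ i < n ] 1 ≡ n
∑-1 zero    = refl
∑-1 (suc n) = cong suc (∑-1 n)

∑-mono-≤ : ∀ {n} {f g : Fin n → ℕ} → (∀ i → f i ≤ g i) → sum f ≤ sum g
∑-mono-≤ {zero}  f≤g = z≤n
∑-mono-≤ {suc n} f≤g = +-mono-≤ (f≤g zero) (∑-mono-≤ (f≤g ∘ suc))

count : ∀ {n} → (Fin n → Bool) → ℕ
count {n} p = ∑[ i < n ] boolToℕ (p i)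

count-≟ : ∀ {n} (a : Fin n) → count (λ b → does (a ≟ b)) ≡ 1
count-≟ {suc n} zero    = cong suc (sum-replicate-zero n)
count-≟ {suc n} (suc a) = count-≟ a

∃-above-average : ∀ {n} (f : Fin n → ℕ) {c} → n * c < sum f → ∃[ i ] c < f i
∃-above-average {suc n} f {c} nc<∑ with c <? f zero
... | yes c<f₀ = zero , c<f₀
... | no  c≮f₀ =
  let i , c<fi = ∃-above-average (f ∘ suc)
                   (+-cancelˡ-< c _ _ (<-≤-trans nc<∑ (+-monoˡ-≤ _ (≮⇒≥ c≮f₀))))
  in suc i , c<fi

_⊆_ : ∀ {n} → (Fin n → Bool) → (Fin n → Bool) → Set
q ⊆ p = ∀ i → q i ≡ true → p i ≡ true

∃-⊆-count : ∀ {n} (p : Fin n → Bool) {s} → s ≤ count p → ∃[ q ] q ⊆ p × count q ≡ s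
∃-⊆-count {n} p {zero} _ = (λ _ → false) , (λ _ ()) , sum-replicate-zero n
∃-⊆-count {suc n} p {suc s} s<∑ with p zero in p₀
... | true  = let q , q⊆p , ∣q∣ = ∃-⊆-count (p ∘ suc) (≤-pred s<∑) in
  (λ { zero → true ; (suc i) → q i }) , (λ { zero _ → p₀ ; (suc i) → q⊆p i }) , cong suc ∣q∣
... | false = let q , q⊆p , ∣q∣ = ∃-⊆-count (p ∘ suc) s<∑ in
  (λ { zero → false ; (suc i) → q i }) , (λ { zero () ; (suc i) → q⊆p i }) , ∣q∣

count-pos⇒∃ : ∀ {n} (p : Fin n → Bool) → 0 < count p → ∃[ i ] p i ≡ true
count-pos⇒∃ {suc n} p ∑>0 with p zero in p₀
... | true  = zero , p₀
... | false = let i , pi = count-pos⇒∃ (p ∘ suc) ∑>0 in suc i , pi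

does-true⇒ : ∀ {A : Set} (a? : Dec A) → does a? ≡ true → A
does-true⇒ (yes a) _ = a

module _ {n} (Γ : Digraph n) where

  Reach : Fin n → Fin n → Set
  Reach a b = a ≡ b ⊎ Edge Γ a b

  -- Built so that `reachᵇ a b` computes to `does (a ≟ b) ∨ edge Γ a b`.
  reach? : ∀ a b → Dec (Reach a b)
  reach? a b = a ≟ b ⊎-dec Dec.map T-≡ (T? (edge Γ a b))

  reachᵇ : Fin n → Fin n → Bool
  reachᵇ a b = does (reach? a b)

  componentᵇ : Fin n → Fin n → Bool
  componentᵇ v a = does (reach? v a ×-dec reach? a v)

  outReach inReach : Fin n → ℕ
  outReach a = count (reachᵇ a)
  inReach  b = count (λ a → reachᵇ a b)

  boolToℕ-reachᵇ : ∀ a b → boolToℕ (reachᵇ a b) ≡ boolToℕ (does (a ≟ b)) + boolToℕ (edge Γ a b)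
  boolToℕ-reachᵇ a b with a ≟ b
  ... | yes refl rewrite loopless Γ a = refl
  ... | no  _    = refl

  outReach≡1+count-edge : ∀ a → outReach a ≡ suc (count (edge Γ a))
  outReach≡1+count-edge a =
    trans (sum-cong-≗ {n} (boolToℕ-reachᵇ a))
          (trans (∑-distrib-+ {n} _ _) (cong (_+ count (edge Γ a)) (count-≟ a)))

  numEdges≡∑count-edge : numEdges Γ ≡ ∑[ a < n ] count (edge Γ a)
  numEdges≡∑count-edge =
    trans (sum-map-allFin (λ a → Listℕ.sum (List.map (λ b → boolToℕ (edge Γ a b)) (allFin n))))
          (sum-cong-≗ {n} (λ a → sum-map-allFin (boolToℕ ∘ edge Γ a)))

  weight≡∑outReach : weight Γ ≡ ∑[ a < n ] outReach a
  weight≡∑outReach = begin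
    n + numEdges Γ
      ≡⟨ cong₂ _+_ (sym (∑-1 n)) numEdges≡∑count-edge ⟩
    ∑[ a < n ] 1 + ∑[ a < n ] count (edge Γ a)  ≡⟨ ∑-distrib-+ {n} _ _ ⟨
    ∑[ a < n ] suc (count (edge Γ a))           ≡⟨ sum-cong-≗ outReach≡1+count-edge ⟨
    ∑[ a < n ] outReach a                       ∎
    where open ≡-Reasoning

  ∃-heavy-vertex : n * n < weight Γ + weight Γ → ∃[ v ] n < outReach v + inReach v
  ∃-heavy-vertex n²<2w =
    ∃-above-average (λ v → outReach v + inReach v) (subst (n * n <_) ∑out+in n²<2w)
    where
    ∑out+in : weight Γ + weight Γ ≡ ∑[ v < n ] (outReach v + inReach v)
    ∑out+in = begin
      weight Γ + weight Γ
        ≡⟨ cong₂ _+_ weight≡∑outReach weight≡∑outReach ⟩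
      ∑[ v < n ] outReach v + ∑[ a < n ] outReach a
        ≡⟨ cong (∑[ v < n ] outReach v +_) (∑-comm {n} {n} _) ⟩
      ∑[ v < n ] outReach v + ∑[ v < n ] inReach v
        ≡⟨ ∑-distrib-+ {n} _ _ ⟨
      ∑[ v < n ] (outReach v + inReach v)
        ∎
      where open ≡-Reasoning

  out+in∸n≤count-component : ∀ v → outReach v + inReach v ∸ n ≤ count (componentᵇ v)
  out+in∸n≤count-component v = begin
    outReach v + inReach v ∸ n
      ≡⟨ cong (_∸ n) (∑-distrib-+ {n} _ _) ⟨
    ∑[ a < n ] (boolToℕ (reachᵇ v a) + boolToℕ (reachᵇ a v)) ∸ n
      ≤⟨ ∸-monoˡ-≤ n (∑-mono-≤ inclusion-exclusion) ⟩
    ∑[ a < n ] (1 + boolToℕ (componentᵇ v a)) ∸ n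
      ≡⟨ cong (_∸ n) (∑-distrib-+ {n} _ _) ⟩
    ∑[ a < n ] 1 + count (componentᵇ v) ∸ n
      ≡⟨ cong (λ m → m + count (componentᵇ v) ∸ n) (∑-1 n) ⟩
    n + count (componentᵇ v) ∸ n
      ≡⟨ m+n∸m≡n n _ ⟩
    count (componentᵇ v)
      ∎
    where
    open ≤-Reasoning
    inclusion-exclusion : ∀ a →
      boolToℕ (reachᵇ v a) + boolToℕ (reachᵇ a v) ≤ 1 + boolToℕ (componentᵇ v a)
    inclusion-exclusion a with reachᵇ v a | reachᵇ a v
    ... | true  | _     = ≤-refl
    ... | false | true  = ≤-refl
    ... | false | false = z≤n

module _ {n} (Γ : Digraph n) (Γ-trans : IsTransitive Γ) where

  Reach-trans : ∀ {a b c} → Reach Γ a b → Reach Γ b c → Reach Γ a c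
  Reach-trans (inj₁ refl) bc          = bc
  Reach-trans ab          (inj₁ refl) = ab
  Reach-trans {a} {b} {c} (inj₂ ab) (inj₂ bc) with a ≟ c
  ... | yes a≡c = inj₁ a≡c
  ... | no  a≢c = inj₂ (Γ-trans a b c ab bc a≢c)

  reachᵇ-from-component : ∀ {v a} → Reach Γ v a → Reach Γ a v → ∀ b → reachᵇ Γ a b ≡ reachᵇ Γ v b
  reachᵇ-from-component va av b =
    does-⇔ (mk⇔ (Reach-trans va) (Reach-trans av)) (reach? Γ _ b) (reach? Γ _ b)

  reachᵇ-into-component : ∀ {v a} → Reach Γ v a → Reach Γ a v → ∀ b → reachᵇ Γ b a ≡ reachᵇ Γ b v
  reachᵇ-into-component va av b =
    does-⇔ (mk⇔ (λ ba → Reach-trans ba av) (λ bv → Reach-trans bv va)) (reach? Γ b _) (reach? Γ b _)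

raise : ∀ {n} → Digraph n → (Fin n → Bool) → Digraph n
edge (raise Γ S) a b = if S a then not (does (a ≟ b)) else not (S b) ∧ edge Γ a b
loopless (raise Γ S) a with S a
... | true  = cong not (dec-true (a ≟ a) refl)
... | false = loopless Γ a

module _ {n} (Γ : Digraph n) (S : Fin n → Bool) where

  raise-mother : ∀ {a} → S a ≡ true → IsMother (raise Γ S) a
  raise-mother {a} Sa b a≢b rewrite Sa = cong not (dec-false (a ≟ b) a≢b)

  raise-transitive : IsTransitive Γ → IsTransitive (raise Γ S)
  raise-transitive Γ-trans a b c ab bc a≢c with S a | S b | S c
  ... | true  | _     | _     = cong not (dec-false (a ≟ c) a≢c)
  ... | false | false | false = Γ-trans a b c ab bc a≢c

  reachᵇ-raise-from : ∀ {a} → S a ≡ true → ∀ b → reachᵇ (raise Γ S) a b ≡ true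
  reachᵇ-raise-from {a} Sa b rewrite Sa = ∨-inverseʳ (does (a ≟ b))

  reachᵇ-raise-into : ∀ {a b} → S a ≡ false → S b ≡ true → reachᵇ (raise Γ S) a b ≡ false
  reachᵇ-raise-into {a} {b} Sa Sb rewrite Sa | Sb =
    trans (∨-identityʳ _) (dec-false (a ≟ b) (λ { refl → contradiction (trans (sym Sa) Sb) λ () }))

  reachᵇ-raise-outside : ∀ {a b} → S a ≡ false → S b ≡ false → reachᵇ (raise Γ S) a b ≡ reachᵇ Γ a b
  reachᵇ-raise-outside Sa Sb rewrite Sa | Sb = refl

module _ {n} (Γ : Digraph n) (Γ-trans : IsTransitive Γ) (v : Fin n) (S : Fin n → Bool)
         (S⊆component : S ⊆ componentᵇ Γ v) where

  private
    Γ↑ = raise Γ S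
    s  = count S

    component : ∀ {a} → S a ≡ true → Reach Γ v a × Reach Γ a v
    component {a} Sa = does-true⇒ (reach? Γ v a ×-dec reach? Γ a v) (S⊆component a Sa)

  outsideToᵇ : Fin n → Bool
  outsideToᵇ a = not (S a) ∧ reachᵇ Γ a v

  inReach≡count+count-outsideTo : inReach Γ v ≡ s + count outsideToᵇ
  inReach≡count+count-outsideTo = trans (sum-cong-≗ {n} split) (∑-distrib-+ {n} _ _)
    where
    split : ∀ a → boolToℕ (reachᵇ Γ a v) ≡ boolToℕ (S a) + boolToℕ (outsideToᵇ a)
    split a with S a in Sa
    ... | true  = cong boolToℕ (dec-true (reach? Γ a v) (proj₂ (component Sa)))
    ... | false = refl

  outReach-raise-inside : ∀ {a} → S a ≡ true → outReach Γ↑ a ≡ n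
  outReach-raise-inside Sa = trans (sum-cong-≗ {n} (cong boolToℕ ∘ reachᵇ-raise-from Γ S Sa)) (∑-1 n)

  outReach-inside : ∀ {a} → S a ≡ true → outReach Γ a ≡ outReach Γ v
  outReach-inside Sa = sum-cong-≗ {n} (cong boolToℕ ∘ reachᵇ-from-component Γ Γ-trans va av)
    where va = proj₁ (component Sa) ; av = proj₂ (component Sa)

  -- Here and in outReach-row a value of S is abstracted by hand: `with` would also abstract it
  -- inside `raise Γ S`.
  outReach-outside : ∀ {a} → S a ≡ false → outReach Γ a ≡ outReach Γ↑ a + s * boolToℕ (reachᵇ Γ a v)
  outReach-outside {a} Sa = trans (sum-cong-≗ {n} (λ b → split b (S b) refl))
    (trans (∑-distrib-+ {n} _ _) (cong (outReach Γ↑ a +_) (sym (*-distribʳ-sum _ (boolToℕ ∘ S)))))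
    where
    split : ∀ b x → S b ≡ x →
            boolToℕ (reachᵇ Γ a b) ≡ boolToℕ (reachᵇ Γ↑ a b) + boolToℕ x * boolToℕ (reachᵇ Γ a v)
    split b true Sb = begin
      boolToℕ (reachᵇ Γ a b)
        ≡⟨ cong boolToℕ (reachᵇ-into-component Γ Γ-trans vb bv a) ⟩
      boolToℕ (reachᵇ Γ a v)
        ≡⟨ +-identityʳ _ ⟨
      boolToℕ false + 1 * boolToℕ (reachᵇ Γ a v)
        ≡⟨ cong (λ x → boolToℕ x + _) (reachᵇ-raise-into Γ S Sa Sb) ⟨
      boolToℕ (reachᵇ Γ↑ a b) + 1 * boolToℕ (reachᵇ Γ a v)
        ∎
      where
      open ≡-Reasoning
      vb = proj₁ (component Sb)
      bv = proj₂ (component Sb)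
    split b false Sb = trans (cong boolToℕ (sym (reachᵇ-raise-outside Γ S Sa Sb))) (sym (+-identityʳ _))

  private
    outReach-row : ∀ a x → S a ≡ x →
      outReach Γ a + boolToℕ x * n ≡
      outReach Γ↑ a + (boolToℕ x * outReach Γ v + s * boolToℕ (not x ∧ reachᵇ Γ a v))
    outReach-row a true Sa rewrite outReach-inside Sa | outReach-raise-inside Sa =
      rearrange (outReach Γ v) n s
      where
      rearrange : ∀ o n s → o + 1 * n ≡ n + (1 * o + s * 0)
      rearrange = solve-∀
    outReach-row a false Sa = trans (+-identityʳ _) (outReach-outside Sa)

  weight-raise : weight Γ + s * n ≡ weight Γ↑ + s * (outReach Γ v + count outsideToᵇ)
  weight-raise = begin
    weight Γ + s * n
      ≡⟨ cong₂ _+_ (weight≡∑outReach Γ) (*-distribʳ-sum n χS) ⟩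
    ∑[ a < n ] outReach Γ a + ∑[ a < n ] (χS a * n)
      ≡⟨ ∑-distrib-+ {n} _ _ ⟨
    ∑[ a < n ] (outReach Γ a + χS a * n)
      ≡⟨ sum-cong-≗ {n} (λ a → outReach-row a (S a) refl) ⟩
    ∑[ a < n ] (outReach Γ↑ a + (χS a * outReach Γ v + s * χoutsideTo a))
      ≡⟨ ∑-distrib-+ {n} _ _ ⟩
    ∑[ a < n ] outReach Γ↑ a + ∑[ a < n ] (χS a * outReach Γ v + s * χoutsideTo a)
      ≡⟨ cong₂ _+_ (sym (weight≡∑outReach Γ↑)) (∑-distrib-+ {n} _ _) ⟩
    weight Γ↑ + (∑[ a < n ] (χS a * outReach Γ v) + ∑[ a < n ] (s * χoutsideTo a))
      ≡⟨ cong (weight Γ↑ +_) (cong₂ _+_ (*-distribʳ-sum _ χS) (*-distribˡ-sum s χoutsideTo)) ⟨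
    weight Γ↑ + (s * outReach Γ v + s * count outsideToᵇ)
      ≡⟨ cong (weight Γ↑ +_) (*-distribˡ-+ s _ _) ⟨
    weight Γ↑ + s * (outReach Γ v + count outsideToᵇ)
      ∎
    where
    open ≡-Reasoning
    χS χoutsideTo : Fin n → ℕ
    χS          = boolToℕ ∘ S
    χoutsideTo  = boolToℕ ∘ outsideToᵇ

  raise-preserves-weight : n + s ≡ outReach Γ v + inReach Γ v → weight Γ ≡ weight Γ↑
  raise-preserves-weight n+s≡out+in =
    +-cancelʳ-≡ (s * n) _ _ (trans weight-raise (cong (λ m → weight Γ↑ + s * m) out+outsideTo≡n))
    where
    o  = outReach Γ v
    t  = count outsideToᵇ
    out+outsideTo≡n : o + t ≡ n
    out+outsideTo≡n = +-cancelʳ-≡ s _ _ (begin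
      o + t + s   ≡⟨ +-assoc o t s ⟩
      o + (t + s) ≡⟨ cong (o +_) (+-comm t s) ⟩
      o + (s + t) ≡⟨ cong (o +_) inReach≡count+count-outsideTo ⟨
      o + inReach Γ v ≡⟨ n+s≡out+in ⟨
      n + s       ∎)
      where open ≡-Reasoning

theorem1p3 : ∀ (n : ℕ) (Γ : Digraph n) → IsTransitive Γ →
    3 * (n * n) < 4 * weight Γ →
    Σ (Digraph n) (λ Γ' → IsTransitive Γ' × (weight Γ ≡ weight Γ') × ∃ (λ (a : Fin n) → IsMother Γ' a))
theorem1p3 n Γ Γ-trans 3n²<4w
  with v , n<out+in ← ∃-heavy-vertex Γ (3*x<4*y⇒x<y+y (n * n) (weight Γ) 3n²<4w)
  with S , S⊆C , ∣S∣≡excess ← ∃-⊆-count (componentᵇ Γ v) (out+in∸n≤count-component Γ v)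
  with a , Sa ← count-pos⇒∃ S (subst (0 <_) (sym ∣S∣≡excess) (m<n⇒0<n∸m n<out+in))
  = raise Γ S
  , raise-transitive Γ S Γ-trans
  , raise-preserves-weight Γ Γ-trans v S S⊆C n+∣S∣≡out+in
  , a , raise-mother Γ S Sa
  where
  n+∣S∣≡out+in : n + count S ≡ outReach Γ v + inReach Γ v
  n+∣S∣≡out+in = trans (cong (n +_) ∣S∣≡excess) (m+[n∸m]≡n (<⇒≤ n<out+in))
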